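{- Let $p$ be a prime and let $(h_1,\dots,h_n)$ be a MuM position with modulus $p$ whose heap product satisfies $\prod_{i=1}^n h_i \equiv 1 \pmod p$ and which is non-terminal (admits at least one legal move). Then every legal move from this position leads to a position whose heap product is $\not\equiv 1 \pmod p$.
   Context: MuM with prime modulus $p$: a position is a finite multiset of heaps, each a positive integer not divisible by $p$. A legal move consists of choosing a heap $h_i > 1$ and replacing it by $h_i' = h_i - r$, where the integer $r$ satisfies $1 \le r < p$, $r < h_i$, and $h_i'$ is not divisible by $p$. A position is called losing if its heap product is $\equiv 1 \pmod p$ and winning otherwise. -}

module Defs where

open import Data.Nat using (ℕ; zero; suc; _+_; _∸_; _<_; NonZero)
open import Data.Nat.Divisibility using (_∣_)
open import Data.Nat.DivMod using (_%_)
open import Data.List using (List; []; _∷_)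
open import Data.Nat.ListAction using (product)
open import Data.List.Relation.Unary.All using (All)
open import Data.Product using (_×_; ∃)
open import Relation.Nullary using (¬_)
open import Relation.Binary.PropositionalEquality using (_≡_)

-- A MuM position with modulus p: a finite multiset of heaps, represented
-- as a list (order irrelevant), each heap positive and not divisible by p.
MuMPosition : ℕ → List ℕ → Set
MuMPosition p hs = All (λ h → 0 < h × ¬ (p ∣ h)) hs

-- Single-heap move h ↦ h - r with 1 ≤ r < p, r < h, p ∤ (h - r).
-- (r < h implies h > 1 and h - r ≥ 1.)
HeapMove : ℕ → ℕ → ℕ → Set
HeapMove p h h′ = ∃ λ r → 1 Data.Nat.≤ r × r < p × r < h × h′ ≡ h ∸ r × ¬ (p ∣ h′)

data Move (p : ℕ) : List ℕ → List ℕ → Set where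
  here  : ∀ {h h′ hs} → HeapMove p h h′ → Move p (h ∷ hs) (h′ ∷ hs)
  there : ∀ {h hs hs′} → Move p hs hs′ → Move p (h ∷ hs) (h ∷ hs′)

NonTerminal : ℕ → List ℕ → Set
NonTerminal p hs = ∃ λ hs′ → Move p hs hs′

ProdOne : (p : ℕ) → .{{NonZero p}} → List ℕ → Set
ProdOne p hs = product hs % p ≡ 1 % p

-- A move lowers a single heap h to h′ = h − r with 0 < r < p, so the heap product
-- changes from h·P to h′·P, where P is the product of the other heaps.  If both
-- products were ≡ 1 (mod p), then p ∣ r·P, hence p ∣ P since p is prime and p ∤ r;
-- but then h·P ≡ 0 (mod p).
module Submission where

open import Defs
open import Data.Nat using (ℕ; NonZero; NonTrivial; _+_; _*_; _∸_; _<_; >-nonZero; nonTrivial⇒n>1)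
open import Data.Nat.Properties using (*-commutativeSemigroup; *-distribʳ-+; *-distribʳ-∸; [m+n]∸[m+o]≡n∸o; m+n∸m≡n; m∸n+n≡m; <⇒≤; 0≢1+n)
open import Data.Nat.Primality using (Prime; euclidsLemma; prime⇒nonTrivial)
open import Data.Nat.Divisibility using (_∣_; divides; n∣m⇒m%n≡0; >⇒∤; ∣-trans; n∣m*n)
open import Data.Nat.DivMod using (_%_; _/_; m≡m%n+[m/n]*n; m<n⇒m%n≡m)
open import Data.Nat.ListAction using (product)
open import Data.List using (List; _∷_)
open import Data.Product using (_×_; _,_; ∃-syntax)
open import Data.Sum using (inj₁; inj₂)
open import Algebra.Properties.CommutativeSemigroup *-commutativeSemigroup using (x∙yz≈y∙xz)
open import Relation.Nullary using (¬_; contradiction)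
open import Relation.Binary.PropositionalEquality using (_≡_; _≢_; refl; sym; trans; cong; cong₂; module ≡-Reasoning)

%≡%⇒∣∸ : ∀ m n d .{{_ : NonZero d}} → m % d ≡ n % d → d ∣ m ∸ n
%≡%⇒∣∸ m n d eq = divides (m / d ∸ n / d) (begin
  m ∸ n                                          ≡⟨ cong₂ _∸_ (m≡m%n+[m/n]*n m d) (m≡m%n+[m/n]*n n d) ⟩
  (m % d + m / d * d) ∸ (n % d + n / d * d)      ≡⟨ cong (λ k → (m % d + m / d * d) ∸ (k + n / d * d)) (sym eq) ⟩
  (m % d + m / d * d) ∸ (m % d + n / d * d)      ≡⟨ [m+n]∸[m+o]≡n∸o (m % d) (m / d * d) (n / d * d) ⟩
  m / d * d ∸ n / d * d                          ≡⟨ *-distribʳ-∸ d (m / d) (n / d) ⟨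
  (m / d ∸ n / d) * d                            ∎)
  where open ≡-Reasoning

[m+n]%d≡m%d⇒d∣n : ∀ m n d .{{_ : NonZero d}} → (m + n) % d ≡ m % d → d ∣ n
[m+n]%d≡m%d⇒d∣n m n d eq with %≡%⇒∣∸ (m + n) m d eq
... | d∣m+n∸m rewrite m+n∸m≡n m n = d∣m+n∸m

∣⇒%≢1% : ∀ {m d} .{{_ : NonZero d}} → NonTrivial d → d ∣ m → m % d ≢ 1 % d
∣⇒%≢1% {m} {d} d>1 d∣m m%d≡1%d = 0≢1+n (begin
  0       ≡⟨ n∣m⇒m%n≡0 m d d∣m ⟨
  m % d   ≡⟨ m%d≡1%d ⟩
  1 % d   ≡⟨ m<n⇒m%n≡m (nonTrivial⇒n>1 d {{d>1}}) ⟩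
  1       ∎)
  where open ≡-Reasoning

prime∣r*n⇒∣n : ∀ {p r n} → Prime p → 0 < r → r < p → p ∣ r * n → p ∣ n
prime∣r*n⇒∣n {r = r} {n} p-prime 0<r r<p p∣r*n with euclidsLemma r n p-prime p∣r*n
... | inj₁ p∣r = contradiction p∣r (>⇒∤ {{>-nonZero 0<r}} r<p)
... | inj₂ p∣n = p∣n

[m+r]*n%p≡1⇒m*n%p≢1 : ∀ {p r m n} .{{_ : NonZero p}} → Prime p → 0 < r → r < p →
                       (m + r) * n % p ≡ 1 % p → m * n % p ≢ 1 % p
[m+r]*n%p≡1⇒m*n%p≢1 {p} {r} {m} {n} p-prime 0<r r<p [m+r]n≡1 mn≡1 =
  ∣⇒%≢1% (prime⇒nonTrivial p-prime) (∣-trans p∣n (n∣m*n (m + r))) [m+r]n≡1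
  where
  open ≡-Reasoning
  p∣n : p ∣ n
  p∣n = prime∣r*n⇒∣n p-prime 0<r r<p ([m+n]%d≡m%d⇒d∣n (m * n) (r * n) p (begin
    (m * n + r * n) % p   ≡⟨ cong (_% p) (*-distribʳ-+ n m r) ⟨
    (m + r) * n % p       ≡⟨ [m+r]n≡1 ⟩
    1 % p                 ≡⟨ mn≡1 ⟨
    m * n % p             ∎))

heapMove⇒decrement : ∀ {p h h′} → HeapMove p h h′ → ∃[ r ] (0 < r × r < p × h ≡ h′ + r)
heapMove⇒decrement {h = h} (r , 0<r , r<p , r<h , refl , _) = r , 0<r , r<p , sym (m∸n+n≡m (<⇒≤ r<h))

record MoveFactorisation (p : ℕ) (hs hs′ : List ℕ) : Set where
  field
    heap heap′ rest : ℕ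
    heapMove        : HeapMove p heap heap′
    product≡        : product hs ≡ heap * rest
    product′≡       : product hs′ ≡ heap′ * rest

move⇒factorisation : ∀ {p hs hs′} → Move p hs hs′ → MoveFactorisation p hs hs′
move⇒factorisation {hs = h ∷ hs} (here {h′ = h′} m) = record
  { heap = h ; heap′ = h′ ; rest = product hs ; heapMove = m ; product≡ = refl ; product′≡ = refl }
move⇒factorisation {hs = h ∷ _} (there move) = record
  { heap      = heap
  ; heap′     = heap′
  ; rest      = h * rest
  ; heapMove  = heapMove
  ; product≡  = trans (cong (h *_) product≡) (x∙yz≈y∙xz h heap rest)
  ; product′≡ = trans (cong (h *_) product′≡) (x∙yz≈y∙xz h heap′ rest)
  }
  where open MoveFactorisation (move⇒factorisation move)

proposition2 : (p : ℕ) → .{{_ : NonZero p}} → Prime p → (hs : List ℕ) →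
    MuMPosition p hs → ProdOne p hs → NonTerminal p hs →
    (hs′ : List ℕ) → Move p hs hs′ → ¬ ProdOne p hs′
proposition2 p p-prime hs _ prodOne _ hs′ move prodOne′ =
  let open MoveFactorisation (move⇒factorisation move)
      (r , 0<r , r<p , heap≡heap′+r) = heapMove⇒decrement heapMove
      open ≡-Reasoning
  in [m+r]*n%p≡1⇒m*n%p≢1 {m = heap′} {n = rest} p-prime 0<r r<p
       (begin
         (heap′ + r) * rest % p   ≡⟨ cong (λ h → h * rest % p) heap≡heap′+r ⟨
         heap * rest % p          ≡⟨ cong (_% p) product≡ ⟨
         product hs % p           ≡⟨ prodOne ⟩
         1 % p                    ∎)
       (trans (cong (_% p) (sym product′≡)) prodOne′)
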